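{- Let $T$ be a tournament. Then for any choices made in the construction of $\Pi(T)$, $\vec{\chi}(\Pi(T)) > \vec{\chi}(T)$.
   Context: A tournament is an orientation of a complete graph. The dichromatic number $\vec{\chi}(D)$ of a digraph $D$ is the minimum number of parts in a partition of $V(D)$ into sets each inducing an acyclic subdigraph. Construction of $\Pi(T)$ for a tournament $T$ on $n$ vertices: let $m = \binom{2n-1}{n}$ and take $2m+1$ disjoint copies $A_1,\dots,A_m,B,C_1,\dots,C_m$ of $T$. Fix a bijection $\varphi$ from $\{1,\dots,m\}$ to the set of $n$-element subsets of $\{1,\dots,2n-1\}$, and for each $j$ a bijection $\psi_j : V(T) \to \varphi(j)$; a vertex of $A_j$ or of $C_j$ that is the copy of $t \in V(T)$ receives label $\psi_j(t)$. Start from the tournament in which each copy induces $T$ and all arcs go from earlier to later copies in the sequence $A_1,\dots,A_m,B,C_1,\dots,C_m$; then reverse the arc from $a \in V(A_i)$ to $c \in V(C_j)$ exactly when $a$ and $c$ have the same label. -}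

module Defs where

open import Data.Bool using (Bool; true; false; if_then_else_)
open import Data.Nat using (ℕ; _*_; _∸_; _≤_)
open import Data.Nat.Combinatorics using (_C_)
open import Data.Fin using (Fin; _<?_)
open import Data.Fin.Properties using (_≟_)
open import Data.Fin.Subset using (Subset; _∈_; ∣_∣)
open import Data.List using (List; []; _∷_)
open import Data.List.Relation.Unary.All using (All)
open import Data.List.Relation.Unary.Unique.Propositional using (Unique)
open import Data.Product using (Σ; _×_; _,_; proj₁)
open import Data.Sum using (_⊎_)
open import Data.Empty using (⊥)
open import Function.Bundles using (_⤖_; Bijection)
open import Relation.Binary.PropositionalEquality using (_≡_; _≢_)
open import Relation.Nullary using (does; yes; no)

Digraph : Set → Set
Digraph V = V → V → Bool

Arc : {V : Set} → Digraph V → V → V → Set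
Arc D u v = D u v ≡ true

Chain : {V : Set} → Digraph V → V → List V → V → Set
Chain D x [] z = Arc D x z
Chain D x (y ∷ ys) z = Arc D x y × Chain D y ys z

IsCycle : {V : Set} → Digraph V → V → List V → Set
IsCycle D x ys = Unique (x ∷ ys) × Chain D x ys x

Acyclic : {V : Set} → Digraph V → (V → Set) → Set
Acyclic D S = ∀ x ys → IsCycle D x ys → All S (x ∷ ys) → ⊥

DiColourable : {V : Set} → Digraph V → ℕ → Set
DiColourable {V} D k =
  Σ (V → Fin k) λ c → ∀ (i : Fin k) → Acyclic D (λ v → c v ≡ i)

IsDichromaticNumber : {V : Set} → Digraph V → ℕ → Set
IsDichromaticNumber D k = DiColourable D k × (∀ j → DiColourable D j → k ≤ j)

record Tournament (n : ℕ) : Set where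
  field
    adj     : Digraph (Fin n)
    irrefl  : ∀ v → adj v v ≡ false
    total   : ∀ u v → u ≢ v → adj u v ≡ true ⊎ adj v u ≡ true
    antisym : ∀ u v → adj u v ≡ true → adj v u ≡ false

-- labels live in {1,…,2n-1}, represented as Fin (2n-1)
LabelCount : ℕ → ℕ
LabelCount n = 2 * n ∸ 1

M : ℕ → ℕ
M n = LabelCount n C n

NSubset : ℕ → Set
NSubset n = Σ (Subset (LabelCount n)) λ s → ∣ s ∣ ≡ n

Member : {k : ℕ} → Subset k → Set
Member {k} s = Σ (Fin k) λ x → x ∈ s

-- the copies, in the order A₁,…,Aₘ,B,C₁,…,Cₘ
data Copy (m : ℕ) : Set where
  A : Fin m → Copy m
  B : Copy m
  C : Fin m → Copy m

PiVertex : ℕ → Set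
PiVertex n = Copy (M n) × Fin n

module Construction {n : ℕ} (T : Tournament n)
  (φ : Fin (M n) ⤖ NSubset n)
  (ψ : (j : Fin (M n)) → Fin n ⤖ Member (proj₁ (Bijection.to φ j))) where

  label : Fin (M n) → Fin n → Fin (LabelCount n)
  label j t = proj₁ (Bijection.to (ψ j) t)

  sameLabel : Fin (M n) → Fin n → Fin (M n) → Fin n → Bool
  sameLabel i s j t = does (label i s ≟ label j t)

  not : Bool → Bool
  not true = false
  not false = true

  Pi : Digraph (PiVertex n)
  Pi (A i , s) (A j , t) with i ≟ j
  ... | yes _ = Tournament.adj T s t
  ... | no _ = does (i <? j)
  Pi (A i , s) (B , t) = true
  Pi (A i , s) (C j , t) = not (sameLabel i s j t)
  Pi (B , s) (A j , t) = false
  Pi (B , s) (B , t) = Tournament.adj T s t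
  Pi (B , s) (C j , t) = true
  Pi (C i , s) (A j , t) = sameLabel j t i s
  Pi (C i , s) (B , t) = false
  Pi (C i , s) (C j , t) with i ≟ j
  ... | yes _ = Tournament.adj T s t
  ... | no _ = does (i <? j)

Π : {n : ℕ} (T : Tournament n)
  (φ : Fin (M n) ⤖ NSubset n)
  (ψ : (j : Fin (M n)) → Fin n ⤖ Member (proj₁ (Bijection.to φ j))) →
  Digraph (PiVertex n)
Π T φ ψ = Construction.Pi T φ ψ

-- Colour Π(T) properly with k + 1 colours and let κ be the colour of one vertex b of B.
-- Every vertex of A_i and every vertex of C_j forms a directed triangle with b when they
-- share a label, so the labels carried by κ-coloured vertices of the A-copies and those
-- carried by κ-coloured vertices of the C-copies are disjoint subsets of the 2n − 1
-- labels. One of the two therefore misses at least n labels; some n of them form φ(j),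
-- and then A_j (or C_j) is a copy of T without colour κ, i.e. T is k-dicolourable.
module Submission where

open import Defs
open import Data.Nat using (ℕ; zero; suc; _+_; _∸_; _≤_; _<_; s≤s; _<?_)
open import Data.Nat.Properties
  using (≤-reflexive; +-comm; +-identityʳ; +-monoʳ-<; m+n≤o⇒m≤o∸n; ∸-monoʳ-≤; ≮⇒≥; module ≤-Reasoning)
open import Data.Fin using (Fin; zero; suc; punchIn; punchOut)
open import Data.Fin.Properties using (punchIn-punchOut; any?; ¬Fin0) renaming (_≟_ to _≟ᶠ_)
open import Data.Fin.Subset using (Subset; inside; outside; _∈_; _⊆_; ∁; ∣_∣) renaming (⊥ to ∅)
open import Data.Fin.Subset.Properties
  using (⊥⊆; ∣⊥∣≡0; in⊆in; out⊆; p⊆q⇒∣p∣≤∣q∣; ∣∁p∣≡n∸∣p∣; x∈∁p⇒x∉p; x∉∁p⇒x∈p; x∉p⇒x∈∁p)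
open import Data.Vec using (_∷_; []; here; there)
open import Data.Product using (∃; ∃₂; _×_; _,_; proj₁; proj₂)
open import Data.Sum using (_⊎_; inj₁; inj₂)
open import Data.List using ([]; _∷_; map)
open import Data.List.Relation.Unary.All as All using ([]; _∷_)
open import Data.List.Relation.Unary.AllPairs using ([]; _∷_)
import Data.List.Relation.Unary.All.Properties as All
import Data.List.Relation.Unary.Unique.Propositional.Properties as Unique
open import Function using (_∘_)
open import Function.Bundles using (_⤖_; Bijection)
open import Function.Definitions using (Injective)
open import Level using (Level; 0ℓ)
open import Relation.Binary.PropositionalEquality using (_≡_; _≢_; refl; sym; trans; cong; subst)
open import Relation.Nullary using (yes; no; does; contradiction)
open import Relation.Nullary.Decidable using (_×-dec_; dec-true)
open import Relation.Unary using (Pred; Decidable)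

private
  variable
    ℓ : Level
    V W : Set
    k : ℕ

IsDiColouring : Digraph V → (V → Fin k) → Set
IsDiColouring D c = ∀ i → Acyclic D (λ v → c v ≡ i)

Acyclic-⊆ : {D : Digraph V} {S S′ : V → Set} →
  Acyclic D S → (∀ {v} → S′ v → S v) → Acyclic D S′
Acyclic-⊆ acyclic S′⊆S x ys cycle inS′ = acyclic x ys cycle (All.map S′⊆S inS′)

module _ {D : Digraph V} {G : Digraph W} {e : V → W}
         (arcs : ∀ s t → G (e s) (e t) ≡ D s t) where

  Chain-map : ∀ x ys z → Chain D x ys z → Chain G (e x) (map e ys) (e z)
  Chain-map x []       z arc           = trans (arcs x z) arc
  Chain-map x (y ∷ ys) z (arc , chain) = trans (arcs x y) arc , Chain-map y ys z chain

  Acyclic-pullback : Injective _≡_ _≡_ e → {S : W → Set} → Acyclic G S → Acyclic D (S ∘ e)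
  Acyclic-pullback inj acyclic x ys (unique , chain) inS =
    acyclic (e x) (map e ys) (Unique.map⁺ inj unique , Chain-map x ys x chain) (All.map⁺ inS)

  IsDiColouring-pullback : Injective _≡_ _≡_ e → {c : W → Fin k} →
    IsDiColouring G c → IsDiColouring D (c ∘ e)
  IsDiColouring-pullback inj colouring i = Acyclic-pullback inj (colouring i)

DiColourable-dropColour : {D : Digraph V} {c : V → Fin (suc k)} → IsDiColouring D c →
  (κ : Fin (suc k)) → (∀ v → κ ≢ c v) → DiColourable D k
DiColourable-dropColour colouring κ unused =
  (λ v → punchOut (unused v)) ,
  λ i → Acyclic-⊆ (colouring (punchIn κ i))
          (λ {v} eq → trans (sym (punchIn-punchOut (unused v))) (cong (punchIn κ) eq))

decSubset : {P : Pred (Fin k) ℓ} → Decidable P → Subset k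
decSubset {k = zero}  P? = []
decSubset {k = suc k} P? = does (P? zero) ∷ decSubset (P? ∘ suc)

∈-decSubset⁺ : {P : Pred (Fin k) ℓ} (P? : Decidable P) {x : Fin k} → P x → x ∈ decSubset P?
∈-decSubset⁺ P? {zero} px with P? zero
... | yes _  = here
... | no ¬px = contradiction px ¬px
∈-decSubset⁺ P? {suc x} px = there (∈-decSubset⁺ (P? ∘ suc) px)

∈-decSubset⁻ : {P : Pred (Fin k) ℓ} (P? : Decidable P) {x : Fin k} → x ∈ decSubset P? → P x
∈-decSubset⁻ P? {zero} x∈ with P? zero | x∈
... | yes px | _ = px
∈-decSubset⁻ P? {suc x} (there x∈) = ∈-decSubset⁻ (P? ∘ suc) x∈

⊆-ofSize : (r : Subset k) (m : ℕ) → m ≤ ∣ r ∣ → ∃ λ s → s ⊆ r × ∣ s ∣ ≡ m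
⊆-ofSize {k} r zero _ = ∅ , ⊥⊆ , ∣⊥∣≡0 k
⊆-ofSize (inside ∷ r) (suc m) (s≤s m≤∣r∣) with ⊆-ofSize r m m≤∣r∣
... | s , s⊆r , ∣s∣≡m = inside ∷ s , in⊆in s⊆r , cong suc ∣s∣≡m
⊆-ofSize (outside ∷ r) (suc m) m<∣r∣ with ⊆-ofSize r (suc m) m<∣r∣
... | s , s⊆r , ∣s∣≡m = outside ∷ s , out⊆ s⊆r , ∣s∣≡m

∁-pigeonhole : ∀ {a b} {p q : Subset k} → a + b < k → p ⊆ ∁ q → a < ∣ ∁ p ∣ ⊎ b < ∣ ∁ q ∣
∁-pigeonhole {k} {a} {b} {p} {q} a+b<k p⊆∁q with a <? ∣ ∁ p ∣
... | yes a<∣∁p∣ = inj₁ a<∣∁p∣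
... | no  a≮∣∁p∣ = inj₂ (begin
  suc b          ≤⟨ m+n≤o⇒m≤o∸n (suc b) (subst (_≤ k) (cong suc (+-comm a b)) a+b<k) ⟩
  k ∸ a          ≤⟨ ∸-monoʳ-≤ k (≮⇒≥ a≮∣∁p∣) ⟩
  k ∸ ∣ ∁ p ∣     ≡⟨ sym (∣∁p∣≡n∸∣p∣ (∁ p)) ⟩
  ∣ ∁ (∁ p) ∣     ≤⟨ p⊆q⇒∣p∣≤∣q∣ {q = p} (x∉∁p⇒x∈p ∘ x∈∁p⇒x∉p) ⟩
  ∣ p ∣           ≤⟨ p⊆q⇒∣p∣≤∣q∣ p⊆∁q ⟩
  ∣ ∁ q ∣         ∎)
  where open ≤-Reasoning

LabelCount-suc : ∀ n → n + n < LabelCount (suc n)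
LabelCount-suc n = +-monoʳ-< n (s≤s (≤-reflexive (sym (+-identityʳ n))))

module _ {n : ℕ} (T : Tournament n)
         (φ : Fin (M n) ⤖ NSubset n)
         (ψ : (j : Fin (M n)) → Fin n ⤖ Member (proj₁ (Bijection.to φ j))) where

  open Construction T φ ψ using (Pi; label)
  open Tournament T using (adj)

  Pi-withinCopy : ∀ x s t → Pi (x , s) (x , t) ≡ adj s t
  Pi-withinCopy (A i) s t with i ≟ᶠ i
  ... | yes _  = refl
  ... | no i≢i = contradiction refl i≢i
  Pi-withinCopy B     s t = refl
  Pi-withinCopy (C i) s t with i ≟ᶠ i
  ... | yes _  = refl
  ... | no i≢i = contradiction refl i≢i

  Pi-copy-DiColourable : ∀ {k} {c : PiVertex n → Fin (suc k)} → IsDiColouring Pi c →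
    (x : Copy (M n)) (κ : Fin (suc k)) → (∀ t → κ ≢ c (x , t)) → DiColourable adj k
  Pi-copy-DiColourable colouring x κ unused =
    DiColourable-dropColour (IsDiColouring-pullback (Pi-withinCopy x) (cong proj₂) colouring) κ unused

  copy-avoiding : (L : Subset (LabelCount n)) → n ≤ ∣ ∁ L ∣ →
    ∃ λ j → ∀ t → label j t ∈ ∁ L
  copy-avoiding L n≤∣∁L∣ with ⊆-ofSize (∁ L) n n≤∣∁L∣
  ... | S , S⊆∁L , ∣S∣≡n with Bijection.strictlySurjective φ (S , ∣S∣≡n)
  ... | j , φj≡S = j , λ t →
    S⊆∁L (subst (label j t ∈_) (cong proj₁ φj≡S) (proj₂ (Bijection.to (ψ j) t)))

module _ {n : ℕ} (T : Tournament (suc n))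
         (φ : Fin (M (suc n)) ⤖ NSubset (suc n))
         (ψ : (j : Fin (M (suc n))) → Fin (suc n) ⤖ Member (proj₁ (Bijection.to φ j)))
         {k : ℕ} (c : PiVertex (suc n) → Fin (suc k)) (colouring : IsDiColouring (Π T φ ψ) c) where

  open Construction T φ ψ using (Pi; label)
  open Tournament T using (adj)

  κ : Fin (suc k)
  κ = c (B , zero)

  κ-triangle-free : ∀ {i s j t} → c (A i , s) ≡ κ → c (C j , t) ≡ κ → label i s ≢ label j t
  κ-triangle-free {i} {s} {j} {t} cA≡κ cC≡κ same =
    colouring κ (A i , s) ((B , zero) ∷ (C j , t) ∷ [])
      ( (((λ ()) ∷ (λ ()) ∷ []) ∷ ((λ ()) ∷ []) ∷ [] ∷ [])
      , refl , refl , dec-true (label i s ≟ᶠ label j t) same)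
      (cA≡κ ∷ refl ∷ cC≡κ ∷ [])

  CopyFamily : Set
  CopyFamily = Fin (M (suc n)) → Copy (M (suc n))

  κ-Labelled : CopyFamily → Pred (Fin (LabelCount (suc n))) 0ℓ
  κ-Labelled X ℓ = ∃₂ λ i s → c (X i , s) ≡ κ × label i s ≡ ℓ

  κ-labelled? : ∀ X → Decidable (κ-Labelled X)
  κ-labelled? X ℓ = any? λ i → any? λ s → (c (X i , s) ≟ᶠ κ) ×-dec (label i s ≟ᶠ ℓ)

  κ-labels : CopyFamily → Subset (LabelCount (suc n))
  κ-labels X = decSubset (κ-labelled? X)

  κ-labels-disjoint : κ-labels A ⊆ ∁ (κ-labels C)
  κ-labels-disjoint ℓ∈A = x∉p⇒x∈∁p λ ℓ∈C →
    let (i , s , cA≡κ , ℓA) = ∈-decSubset⁻ (κ-labelled? A) ℓ∈A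
        (j , t , cC≡κ , ℓC) = ∈-decSubset⁻ (κ-labelled? C) ℓ∈C
    in κ-triangle-free cA≡κ cC≡κ (trans ℓA (sym ℓC))

  κ-labels-complete : ∀ X {j t} → c (X j , t) ≡ κ → label j t ∈ κ-labels X
  κ-labels-complete X {j} {t} cX≡κ = ∈-decSubset⁺ (κ-labelled? X) (j , t , cX≡κ , refl)

  DiColourable-if-fewLabels : ∀ X → suc n ≤ ∣ ∁ (κ-labels X) ∣ → DiColourable adj k
  DiColourable-if-fewLabels X large with copy-avoiding T φ ψ (κ-labels X) large
  ... | j , avoids = Pi-copy-DiColourable T φ ψ colouring (X j) κ
    λ t κ≡c → x∈∁p⇒x∉p (avoids t) (κ-labels-complete X (sym κ≡c))

  Π-DiColourable⇒DiColourable : DiColourable adj k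
  Π-DiColourable⇒DiColourable with ∁-pigeonhole (LabelCount-suc n) κ-labels-disjoint
  ... | inj₁ A-large = DiColourable-if-fewLabels A A-large
  ... | inj₂ C-large = DiColourable-if-fewLabels C C-large

lemma4p5 : (n : ℕ) → 1 ≤ n → (T : Tournament n)
    → (φ : Fin (M n) ⤖ NSubset n)
    → (ψ : (j : Fin (M n)) → Fin n ⤖ Member (proj₁ (Bijection.to φ j)))
    → (p q : ℕ)
    → IsDichromaticNumber (Tournament.adj T) p
    → IsDichromaticNumber (Π T φ ψ) q
    → p < q
lemma4p5 (suc n) _ T φ ψ p zero    _           ((c , _) , _) = contradiction (c (B , zero)) ¬Fin0
lemma4p5 (suc n) _ T φ ψ p (suc k) (_ , minimal) ((c , colouring) , _) =
  s≤s (minimal k (Π-DiColourable⇒DiColourable T φ ψ c colouring))
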